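{- Consider the path network described in the context, satisfying the GPG condition with parameter $\epsilon$, operated under the tree priority policy $\mathbf{TP}$ from the empty state. Then $\mathbb E[Q_2(t)]\le 2\epsilon^{ -1}$ for all $t>0$.
   Context: Path network: types $1,\dots,n$ with $n\ge 4$, matches $m(j,j+1)$ for $1\le j\le n-1$ with rewards $r_j>0$, incidence matrix $M$; in each period one agent arrives, of type $i$ with probability $\lambda_i>0$ i.i.d. ($\sum\lambda_i=1$). $\mathrm{SPP}(\lambda)$: maximize $r^\top z$ s.t. $Mz+s=\lambda$, $z,s\ge 0$; GPG: a non-degenerate optimal basic solution $(z^*,s^*)$ exists; $\epsilon=\min(\min_{z^*_m>0}z^*_m,\min_{s^*_i>0}s^*_i)$. Assume all matches are active ($z^*_j>0$ for all $j$) and the under-demanded set is $\{i:s^*_i>0\}=\{n\}$. Queue $n$ is truncated. $\mathbf{TP}$: an arriving type-$i$ agent is matched with queue $i-1$ if $i\ge 2$ and it is non-empty, otherwise with queue $i+1$ if $i\le n-1$ and it is non-empty, otherwise it joins queue $i$ (discarded if $i=n$). $Q_i(t)$ is the number of waiting type-$i$ agents after period $t$, $Q(0)=0$. -}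

module Defs where

open import Level using (0ℓ)
open import Data.Nat as ℕ using (ℕ; zero; suc)
open import Data.Fin using (Fin; zero; suc; inject₁; fromℕ; _≟_)
open import Data.Maybe using (Maybe; just; nothing)
import Data.Maybe as Maybe
open import Data.Product using (Σ; _×_; ∃)
open import Data.Sum using (_⊎_)
open import Relation.Nullary using (¬_; yes; no)
open import Relation.Binary.PropositionalEquality using (_≡_; _≢_)
open import Algebra.Core using (Op₁; Op₂)
import Algebra.Structures
import Relation.Binary.Structures
open import Relation.Binary.Core using (Rel)

record OrderedField : Set₁ where
  infixl 6 _+_
  infixl 7 _*_
  infix 4 _≤_
  field
    Carrier : Set
    _+_ _*_ : Op₂ Carrier
    -_      : Op₁ Carrier
    0# 1#   : Carrier
    _≤_     : Rel Carrier 0ℓ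
  field
    isCommutativeRing : Algebra.Structures.IsCommutativeRing (_≡_ {A = Carrier}) _+_ _*_ -_ 0# 1#
    isTotalOrder      : Relation.Binary.Structures.IsTotalOrder (_≡_ {A = Carrier}) _≤_
    0≢1      : 0# ≢ 1#
    inverse  : ∀ x → x ≢ 0# → Σ Carrier (λ y → x * y ≡ 1#)
    +-mono-≤ : ∀ {a b} c → a ≤ b → a + c ≤ b + c
    *-nonneg : ∀ {a b} → 0# ≤ a → 0# ≤ b → 0# ≤ a * b

  infix 4 _<_
  _<_ : Rel Carrier 0ℓ
  a < b = (a ≤ b) × (a ≢ b)

-- The path network with n = suc m types (paper type i ↔ index i-1)
-- and m matches (paper match m(j,j+1) ↔ index j-1, joining inject₁ j
-- and suc j).

module PathNetwork (F : OrderedField) where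
  open OrderedField F public

  sumF : ∀ {k} → (Fin k → Carrier) → Carrier
  sumF {zero}  f = 0#
  sumF {suc k} f = f zero + sumF (λ i → f (suc i))

  ℕ→C : ℕ → Carrier
  ℕ→C zero    = 0#
  ℕ→C (suc k) = 1# + ℕ→C k

  inc : ∀ {m} → Fin (suc m) → Fin m → Carrier
  inc i j with i ≟ inject₁ j | i ≟ suc j
  ... | yes _ | _     = 1#
  ... | no _  | yes _ = 1#
  ... | no _  | no _  = 0#

  Mz : ∀ {m} → (Fin m → Carrier) → Fin (suc m) → Carrier
  Mz z i = sumF (λ j → inc i j * z j)

  Feasible : ∀ {m} → (Fin (suc m) → Carrier) → (Fin m → Carrier) → (Fin (suc m) → Carrier) → Set
  Feasible lam z s = (∀ i → Mz z i + s i ≡ lam i) × (∀ j → 0# ≤ z j) × (∀ i → 0# ≤ s i)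

  objective : ∀ {m} → (Fin m → Carrier) → (Fin m → Carrier) → Carrier
  objective r z = sumF (λ j → r j * z j)

  Optimal : ∀ {m} → (Fin m → Carrier) → (Fin (suc m) → Carrier) → (Fin m → Carrier) → (Fin (suc m) → Carrier) → Set
  Optimal r lam z s = Feasible lam z s ×
    (∀ z′ s′ → Feasible lam z′ s′ → objective r z′ ≤ objective r z)

  State : ℕ → Set
  State m = Fin (suc m) → ℕ

  empty : ∀ {m} → State m
  empty _ = 0

  update : ∀ {m} → State m → Fin (suc m) → ℕ → State m
  update Q j v k with k ≟ j
  ... | yes _ = v
  ... | no _  = Q k

  left : ∀ {m} → Fin (suc m) → Maybe (Fin (suc m))
  left zero    = nothing
  left (suc k) = just (inject₁ k)

  right : ∀ {m} → Fin (suc m) → Maybe (Fin (suc m))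
  right {zero}  _       = nothing
  right {suc m} zero    = just (suc zero)
  right {suc m} (suc i) = Maybe.map suc (right {m} i)

  -- second priority: queue i+1; otherwise join queue i (discard if i = n)
  tryRight : ∀ {m} → State m → Fin (suc m) → State m
  tryRight Q i with right i
  ... | nothing = Q
  ... | just j with Q j
  ...   | zero  = update Q i (suc (Q i))
  ...   | suc k = update Q j k

  step : ∀ {m} → State m → Fin (suc m) → State m
  step Q i with left i
  ... | nothing = tryRight Q i
  ... | just j with Q j
  ...   | zero  = tryRight Q i
  ...   | suc k = update Q j k

  -- expect lam t f Q = E[ f(state after t more i.i.d. arrivals from Q) ]
  expect : ∀ {m} → (Fin (suc m) → Carrier) → ℕ → (State m → Carrier) → State m → Carrier
  expect lam zero    f Q = f Q
  expect lam (suc t) f Q = sumF (λ i → lam i * expect lam t f (step Q i))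

{-# OPTIONS --safe #-}
-- Under TP an arrival of type 1 or 3 always takes an agent from a nonempty queue 2 (type 1 has
-- no left neighbour, and queue 2 is type 3's first choice), an arrival of type 2 adds at most one
-- agent to it, and no other arrival touches it.  Hence Q₂ is dominated by a lazy walk on ℕ that
-- steps up with probability p = λ₂ and down with probability q = λ₁ + λ₃, and induction on t
-- gives the geometric tail P(Q₂(t) ≥ j) ≤ ρ^j with ρ = p/q.  Summing the tails,
-- (q - p) E[Q₂(t)] ≤ (q - p)(ρ + ⋯ + ρ^t) ≤ p ≤ 1, and feasibility of (z*, s*) with s*₂ = 0
-- gives q - p = z*₃ + s*₁ + s*₃ ≥ ε.
module Submission where

open import Level using (0ℓ)
open import Defs
open import Data.Nat as ℕ using (ℕ; zero; suc; _∸_)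
import Data.Nat
import Data.Nat.Properties as ℕ
open import Data.Fin using (Fin; zero; suc; fromℕ)
import Data.Fin
open import Data.Maybe using (just; nothing)
open import Data.Product using (Σ; _,_; proj₁; proj₂)
open import Data.Sum using (_⊎_; inj₁; inj₂)
open import Data.Empty using (⊥-elim)
open import Relation.Nullary using (¬_; yes; no)
open import Relation.Binary.PropositionalEquality
  using (_≡_; _≢_; refl; sym; trans; cong; cong₂; subst; subst₂; module ≡-Reasoning)
open import Relation.Binary.Bundles using (Poset)
import Relation.Binary.Structures as Structures
open import Algebra.Bundles using (CommutativeRing; Semiring)
import Algebra.Definitions.RawSemiring as RawSemiringDefinitions
import Algebra.Properties.Group as GroupProperties
import Algebra.Properties.Ring as RingProperties
import Algebra.Solver.Ring.NaturalCoefficients.Default as SemiringSolver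
import Relation.Binary.Reasoning.PartialOrder as PosetReasoning

module _ (F : OrderedField) where
  open PathNetwork F

  module OrderedFieldProperties where

    commutativeRing : CommutativeRing 0ℓ 0ℓ
    commutativeRing = record { isCommutativeRing = isCommutativeRing }

    module R = CommutativeRing commutativeRing
    open RawSemiringDefinitions (Semiring.rawSemiring R.semiring) public using (_^_)
    open GroupProperties R.+-group public using (//-rightDividesˡ)
    open RingProperties R.ring public using (+-cancelˡ; -‿distribʳ-*; -1*x≈-x; -‿involutive)
    open SemiringSolver R.commutativeSemiring public using (solve; _:=_; _:+_; _:*_; con)
    open Structures.IsTotalOrder isTotalOrder public
      using () renaming (refl to ≤-refl; reflexive to ≤-reflexive; trans to ≤-trans;
                         antisym to ≤-antisym; total to ≤-total)

    ≤-poset : Poset 0ℓ 0ℓ 0ℓ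
    ≤-poset = record { isPartialOrder = Structures.IsTotalOrder.isPartialOrder isTotalOrder }

    module ≤-Reasoning = PosetReasoning ≤-poset

    +-monoʳ-≤ : ∀ c {a b} → a ≤ b → c + a ≤ c + b
    +-monoʳ-≤ c {a} {b} a≤b = subst₂ _≤_ (R.+-comm a c) (R.+-comm b c) (+-mono-≤ c a≤b)

    +-mono₂-≤ : ∀ {a b c d} → a ≤ b → c ≤ d → a + c ≤ b + d
    +-mono₂-≤ {b = b} {c} a≤b c≤d = ≤-trans (+-mono-≤ c a≤b) (+-monoʳ-≤ b c≤d)

    x≤x+y : ∀ {x} y → 0# ≤ y → x ≤ x + y
    x≤x+y {x} y 0≤y = subst (_≤ x + y) (R.+-identityʳ x) (+-monoʳ-≤ x 0≤y)

    +-nonneg : ∀ {a b} → 0# ≤ a → 0# ≤ b → 0# ≤ a + b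
    +-nonneg {a} 0≤a 0≤b = ≤-trans 0≤a (x≤x+y _ 0≤b)

    ≤⇒0≤- : ∀ {a b} → a ≤ b → 0# ≤ b + - a
    ≤⇒0≤- {a} {b} a≤b = subst (_≤ b + - a) (R.-‿inverseʳ a) (+-mono-≤ (- a) a≤b)

    0≤-⇒≤ : ∀ {a b} → 0# ≤ b + - a → a ≤ b
    0≤-⇒≤ {a} {b} 0≤b-a = subst₂ _≤_ (R.+-identityˡ a) (//-rightDividesˡ a b) (+-mono-≤ a 0≤b-a)

    nonpos⇒neg-nonneg : ∀ {a} → a ≤ 0# → 0# ≤ - a
    nonpos⇒neg-nonneg {a} a≤0 = subst (0# ≤_) (R.+-identityˡ (- a)) (≤⇒0≤- a≤0)

    *-monoˡ-≤-nonneg : ∀ {c a b} → 0# ≤ c → a ≤ b → c * a ≤ c * b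
    *-monoˡ-≤-nonneg {c} {a} {b} 0≤c a≤b = 0≤-⇒≤ (subst (0# ≤_) distrib (*-nonneg 0≤c (≤⇒0≤- a≤b)))
      where
      distrib : c * (b + - a) ≡ c * b + - (c * a)
      distrib = trans (R.distribˡ c b (- a)) (cong (c * b +_) (sym (-‿distribʳ-* c a)))

    *-monoʳ-≤-nonneg : ∀ {c a b} → 0# ≤ c → a ≤ b → a * c ≤ b * c
    *-monoʳ-≤-nonneg {c} {a} {b} 0≤c a≤b = subst₂ _≤_ (R.*-comm c a) (R.*-comm c b) (*-monoˡ-≤-nonneg 0≤c a≤b)

    0≤1 : 0# ≤ 1#
    0≤1 with ≤-total 0# 1#
    ... | inj₁ 0≤1 = 0≤1
    ... | inj₂ 1≤0 = subst (0# ≤_) -1*-1≡1 (*-nonneg 0≤-1 0≤-1)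
      where
      0≤-1 : 0# ≤ - 1#
      0≤-1 = nonpos⇒neg-nonneg 1≤0
      -1*-1≡1 : - 1# * - 1# ≡ 1#
      -1*-1≡1 = trans (-1*x≈-x (- 1#)) (-‿involutive 1#)

    1<1+1 : 1# < 1# + 1#
    1<1+1 = x≤x+y 1# 0≤1 , λ 1≡1+1 → 0≢1 (+-cancelˡ 1# 0# 1# (trans (R.+-identityʳ 1#) 1≡1+1))

    inverse-nonneg : ∀ {x y} → 0# ≤ x → x * y ≡ 1# → 0# ≤ y
    inverse-nonneg {x} {y} 0≤x xy≡1 with ≤-total 0# y
    ... | inj₁ 0≤y = 0≤y
    ... | inj₂ y≤0 = ⊥-elim (0≢1 (≤-antisym 0≤1 1≤0))
      where
      1≤0 : 1# ≤ 0#
      1≤0 = subst₂ _≤_ xy≡1 (R.zeroʳ x) (*-monoˡ-≤-nonneg 0≤x y≤0)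

    pos+nonneg≢0 : ∀ {a b} → 0# < a → 0# ≤ b → a + b ≢ 0#
    pos+nonneg≢0 {a} {b} (0≤a , 0≢a) 0≤b a+b≡0 =
      0≢a (≤-antisym 0≤a (subst (a ≤_) a+b≡0 (x≤x+y b 0≤b)))

    -- a ≤ b is not stable under double negation without decidable equality,
    -- but the strict gap b < c lets totality decide the weaker a ≤ c
    ≤-stable-< : ∀ {a b c} → b < c → ¬ ¬ (a ≤ b) → a ≤ c
    ≤-stable-< {a} {b} {c} (b≤c , b≢c) ¬¬a≤b with ≤-total a c
    ... | inj₁ a≤c = a≤c
    ... | inj₂ c≤a = ⊥-elim (¬¬a≤b λ a≤b → b≢c (≤-antisym b≤c (≤-trans c≤a a≤b)))

  module SumProperties where
    open OrderedFieldProperties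

    sumF-cong : ∀ {k} {f g : Fin k → Carrier} → (∀ i → f i ≡ g i) → sumF f ≡ sumF g
    sumF-cong {zero}  f≡g = refl
    sumF-cong {suc k} f≡g = cong₂ _+_ (f≡g zero) (sumF-cong (λ i → f≡g (suc i)))

    sumF-mono : ∀ {k} {f g : Fin k → Carrier} → (∀ i → f i ≤ g i) → sumF f ≤ sumF g
    sumF-mono {zero}  f≤g = ≤-refl
    sumF-mono {suc k} f≤g = +-mono₂-≤ (f≤g zero) (sumF-mono (λ i → f≤g (suc i)))

    sumF-nonneg : ∀ {k} {f : Fin k → Carrier} → (∀ i → 0# ≤ f i) → 0# ≤ sumF f
    sumF-nonneg {zero}  0≤f = ≤-refl
    sumF-nonneg {suc k} 0≤f = +-nonneg (0≤f zero) (sumF-nonneg (λ i → 0≤f (suc i)))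

    sumF-+ : ∀ {k} (f g : Fin k → Carrier) → sumF (λ i → f i + g i) ≡ sumF f + sumF g
    sumF-+ {zero}  f g = sym (R.+-identityˡ 0#)
    sumF-+ {suc k} f g =
      trans (cong (f zero + g zero +_) (sumF-+ (λ i → f (suc i)) (λ i → g (suc i))))
            (solve 4 (λ a b c d → (a :+ b) :+ (c :+ d) := (a :+ c) :+ (b :+ d)) refl (f zero) (g zero) _ _)

    sumF-*ˡ : ∀ {k} c (f : Fin k → Carrier) → sumF (λ i → c * f i) ≡ c * sumF f
    sumF-*ˡ {zero}  c f = sym (R.zeroʳ c)
    sumF-*ˡ {suc k} c f = trans (cong (c * f zero +_) (sumF-*ˡ c (λ i → f (suc i)))) (sym (R.distribˡ c _ _))

    sumF-*ʳ : ∀ {k} c (f : Fin k → Carrier) → sumF (λ i → f i * c) ≡ sumF f * c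
    sumF-*ʳ c f = trans (sumF-cong (λ i → R.*-comm (f i) c)) (trans (sumF-*ˡ c f) (R.*-comm c (sumF f)))

    ≤-sumF : ∀ {k} {f : Fin k → Carrier} → (∀ i → 0# ≤ f i) → ∀ i → f i ≤ sumF f
    ≤-sumF 0≤f zero    = x≤x+y _ (sumF-nonneg (λ i → 0≤f (suc i)))
    ≤-sumF {f = f} 0≤f (suc i) =
      ≤-trans (≤-sumF (λ i → 0≤f (suc i)) i) (subst (_≤ f zero + tail) (R.+-identityˡ tail) (+-mono-≤ tail (0≤f zero)))
      where
      tail : Carrier
      tail = sumF (λ i → f (suc i))

    ℕ→C-nonneg : ∀ x → 0# ≤ ℕ→C x
    ℕ→C-nonneg zero    = ≤-refl
    ℕ→C-nonneg (suc x) = +-nonneg 0≤1 (ℕ→C-nonneg x)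

    ℕ→C-mono : ∀ {x y} → x ℕ.≤ y → ℕ→C x ≤ ℕ→C y
    ℕ→C-mono {zero} {y} _  = ℕ→C-nonneg y
    ℕ→C-mono (ℕ.s≤s x≤y) = +-monoʳ-≤ 1# (ℕ→C-mono x≤y)

    ^-nonneg : ∀ {ρ} → 0# ≤ ρ → ∀ j → 0# ≤ ρ ^ j
    ^-nonneg 0≤ρ zero    = 0≤1
    ^-nonneg 0≤ρ (suc j) = *-nonneg 0≤ρ (^-nonneg 0≤ρ j)

    [_≤_] : ℕ → ℕ → Carrier
    [ zero  ≤ x     ] = 1#
    [ suc j ≤ zero  ] = 0#
    [ suc j ≤ suc x ] = [ j ≤ x ]

    [≤]-nonneg : ∀ j x → 0# ≤ [ j ≤ x ]
    [≤]-nonneg zero    x       = 0≤1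
    [≤]-nonneg (suc j) zero    = ≤-refl
    [≤]-nonneg (suc j) (suc x) = [≤]-nonneg j x

    [≤]-mono : ∀ j {x y} → x ℕ.≤ y → [ j ≤ x ] ≤ [ j ≤ y ]
    [≤]-mono zero    _                    = ≤-refl
    [≤]-mono (suc j) {zero}  {y} _        = [≤]-nonneg (suc j) y
    [≤]-mono (suc j) {suc x} (ℕ.s≤s x≤y) = [≤]-mono j x≤y

    [≤]-pred : ∀ j y → [ suc j ≤ ℕ.pred y ] ≡ [ suc (suc j) ≤ y ]
    [≤]-pred j zero    = refl
    [≤]-pred j (suc y) = refl

    sumUpTo : ℕ → (ℕ → Carrier) → Carrier
    sumUpTo zero    f = 0#
    sumUpTo (suc N) f = sumUpTo N f + f (suc N)

    sumUpTo-mono : ∀ N {f g : ℕ → Carrier} → (∀ j → f j ≤ g j) → sumUpTo N f ≤ sumUpTo N g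
    sumUpTo-mono zero    f≤g = ≤-refl
    sumUpTo-mono (suc N) f≤g = +-mono₂-≤ (sumUpTo-mono N f≤g) (f≤g (suc N))

    ℕ→C-∸-suc : ∀ N x → ℕ→C (x ∸ N) ≡ [ suc N ≤ x ] + ℕ→C (x ∸ suc N)
    ℕ→C-∸-suc zero    zero    = sym (R.+-identityˡ 0#)
    ℕ→C-∸-suc (suc N) zero    = sym (R.+-identityˡ 0#)
    ℕ→C-∸-suc zero    (suc x) = refl
    ℕ→C-∸-suc (suc N) (suc x) = ℕ→C-∸-suc N x

    ℕ→C-layers : ∀ N x → ℕ→C x ≡ sumUpTo N (λ j → [ j ≤ x ]) + ℕ→C (x ∸ N)
    ℕ→C-layers zero    x = sym (R.+-identityˡ (ℕ→C x))
    ℕ→C-layers (suc N) x = begin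
      ℕ→C x                                                    ≡⟨ ℕ→C-layers N x ⟩
      sumUpTo N [_≤ x ] + ℕ→C (x ∸ N)                          ≡⟨ cong (sumUpTo N [_≤ x ] +_) (ℕ→C-∸-suc N x) ⟩
      sumUpTo N [_≤ x ] + ([ suc N ≤ x ] + ℕ→C (x ∸ suc N))   ≡⟨ sym (R.+-assoc _ _ _) ⟩
      sumUpTo (suc N) [_≤ x ] + ℕ→C (x ∸ suc N)               ∎
      where open ≡-Reasoning

    -- telescopes, since d ρⁿ + q ρⁿ⁺¹ = (d + p) ρⁿ = q ρⁿ
    geometric-identity : ∀ {d p q ρ} → d + p ≡ q → q * ρ ≡ p →
                         ∀ N → d * sumUpTo N (ρ ^_) + q * ρ ^ suc N ≡ p
    geometric-identity {d} {p} {q} {ρ} d+p≡q qρ≡p zero = begin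
      d * 0# + q * (ρ * 1#) ≡⟨ cong₂ _+_ (R.zeroʳ d) (cong (q *_) (R.*-identityʳ ρ)) ⟩
      0# + q * ρ            ≡⟨ R.+-identityˡ _ ⟩
      q * ρ                 ≡⟨ qρ≡p ⟩
      p                     ∎
      where open ≡-Reasoning
    geometric-identity {d} {p} {q} {ρ} d+p≡q qρ≡p (suc N) = begin
      d * (S + ρⁿ) + q * (ρ * ρⁿ)    ≡⟨ solve 5 (λ d S ρⁿ q ρ → d :* (S :+ ρⁿ) :+ q :* (ρ :* ρⁿ) := d :* S :+ (d :+ q :* ρ) :* ρⁿ) refl d S ρⁿ q ρ ⟩
      d * S + (d + q * ρ) * ρⁿ       ≡⟨ cong (λ w → d * S + (d + w) * ρⁿ) qρ≡p ⟩
      d * S + (d + p) * ρⁿ           ≡⟨ cong (λ w → d * S + w * ρⁿ) d+p≡q ⟩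
      d * S + q * ρⁿ                 ≡⟨ geometric-identity d+p≡q qρ≡p N ⟩
      p                              ∎
      where
      open ≡-Reasoning
      S ρⁿ : Carrier
      S  = sumUpTo N (ρ ^_)
      ρⁿ = ρ ^ suc N

    geometric-bound : ∀ {d p q ρ} → 0# ≤ q → 0# ≤ ρ → d + p ≡ q → q * ρ ≡ p →
                      ∀ N → d * sumUpTo N (ρ ^_) ≤ p
    geometric-bound 0≤q 0≤ρ d+p≡q qρ≡p N =
      subst (_ ≤_) (geometric-identity d+p≡q qρ≡p N) (x≤x+y _ (*-nonneg 0≤q (^-nonneg 0≤ρ (suc N))))

  module Expectation {m : ℕ} (lam : Fin (suc m) → Carrier)
                     (lam≥0 : ∀ i → 0# ≤ lam i) (Σlam≡1 : sumF lam ≡ 1#) where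
    open OrderedFieldProperties
    open SumProperties

    expect-suc : ∀ t f Q → expect lam (suc t) f Q ≡ expect lam t (expect lam 1 f) Q
    expect-suc zero    f Q = refl
    expect-suc (suc t) f Q = sumF-cong (λ i → cong (lam i *_) (expect-suc t f (step Q i)))

    expect-mono : ∀ t {f g : State m → Carrier} → (∀ Q → f Q ≤ g Q) → ∀ Q → expect lam t f Q ≤ expect lam t g Q
    expect-mono zero    f≤g Q = f≤g Q
    expect-mono (suc t) f≤g Q = sumF-mono (λ i → *-monoˡ-≤-nonneg (lam≥0 i) (expect-mono t f≤g (step Q i)))

    expect-const : ∀ t c Q → expect lam t (λ _ → c) Q ≡ c
    expect-const zero    c Q = refl
    expect-const (suc t) c Q = begin
      sumF (λ i → lam i * expect lam t (λ _ → c) (step Q i)) ≡⟨ sumF-cong (λ i → cong (lam i *_) (expect-const t c (step Q i))) ⟩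
      sumF (λ i → lam i * c)                                 ≡⟨ sumF-*ʳ c lam ⟩
      sumF lam * c                                           ≡⟨ cong (_* c) Σlam≡1 ⟩
      1# * c                                                 ≡⟨ R.*-identityˡ c ⟩
      c                                                      ∎
      where open ≡-Reasoning

    expect-nonneg : ∀ t {f : State m → Carrier} → (∀ Q → 0# ≤ f Q) → ∀ Q → 0# ≤ expect lam t f Q
    expect-nonneg t {f} 0≤f Q = subst (_≤ expect lam t f Q) (expect-const t 0# Q) (expect-mono t 0≤f Q)

    expect₁-≤ : ∀ {f c Q} → (∀ i → f (step Q i) ≤ c) → expect lam 1 f Q ≤ c
    expect₁-≤ {c = c} {Q} f≤c =
      ≤-trans (sumF-mono (λ i → *-monoˡ-≤-nonneg (lam≥0 i) (f≤c i))) (≤-reflexive (expect-const 1 c Q))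

    expect-+ : ∀ t f g Q → expect lam t (λ Q′ → f Q′ + g Q′) Q ≡ expect lam t f Q + expect lam t g Q
    expect-+ zero    f g Q = refl
    expect-+ (suc t) f g Q =
      trans (sumF-cong (λ i → trans (cong (lam i *_) (expect-+ t f g (step Q i))) (R.distribˡ (lam i) _ _)))
            (sumF-+ (λ i → lam i * expect lam t f (step Q i)) (λ i → lam i * expect lam t g (step Q i)))

    expect-*ˡ : ∀ t c f Q → expect lam t (λ Q′ → c * f Q′) Q ≡ c * expect lam t f Q
    expect-*ˡ zero    c f Q = refl
    expect-*ˡ (suc t) c f Q =
      trans (sumF-cong (λ i → trans (cong (lam i *_) (expect-*ˡ t c f (step Q i)))
                                    (solve 3 (λ l c x → l :* (c :* x) := c :* (l :* x)) refl (lam i) c _)))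
            (sumF-*ˡ c (λ i → lam i * expect lam t f (step Q i)))

    expect-sumUpTo : ∀ t N (f : ℕ → State m → Carrier) Q →
                     expect lam t (λ Q′ → sumUpTo N (λ j → f j Q′)) Q ≡ sumUpTo N (λ j → expect lam t (f j) Q)
    expect-sumUpTo t zero    f Q = expect-const t 0# Q
    expect-sumUpTo t (suc N) f Q =
      trans (expect-+ t (λ Q′ → sumUpTo N (λ j → f j Q′)) (f (suc N)) Q)
            (cong (_+ expect lam t (f (suc N)) Q) (expect-sumUpTo t N f Q))

    module _ (φ : State m → ℕ) (φ-step-≤ : ∀ Q i → φ (step Q i) ℕ.≤ suc (φ Q)) where

      expect-excess≤0 : ∀ Q → φ Q ≡ 0 → ∀ t → expect lam t (λ Q′ → ℕ→C (φ Q′ ∸ t)) Q ≤ 0#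
      expect-excess≤0 Q φQ≡0 zero    = ≤-reflexive (cong ℕ→C φQ≡0)
      expect-excess≤0 Q φQ≡0 (suc t) = begin
        expect lam (suc t) excess Q              ≡⟨ expect-suc t excess Q ⟩
        expect lam t (expect lam 1 excess) Q     ≤⟨ expect-mono t one-step Q ⟩
        expect lam t (λ Q′ → ℕ→C (φ Q′ ∸ t)) Q  ≤⟨ expect-excess≤0 Q φQ≡0 t ⟩
        0#                                       ∎
        where
        open ≤-Reasoning
        excess : State m → Carrier
        excess Q′ = ℕ→C (φ Q′ ∸ suc t)
        one-step : ∀ Q′ → expect lam 1 excess Q′ ≤ ℕ→C (φ Q′ ∸ t)
        one-step Q′ = expect₁-≤ {excess} (λ i → ℕ→C-mono (ℕ.∸-monoˡ-≤ (suc t) (φ-step-≤ Q′ i)))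

      expect-≤-sum-of-tails : ∀ Q → φ Q ≡ 0 → ∀ t →
        expect lam t (λ Q′ → ℕ→C (φ Q′)) Q ≤ sumUpTo t (λ j → expect lam t (λ Q′ → [ j ≤ φ Q′ ]) Q)
      expect-≤-sum-of-tails Q φQ≡0 t = begin
        expect lam t (λ Q′ → ℕ→C (φ Q′)) Q                         ≤⟨ expect-mono t (λ Q′ → ≤-reflexive (ℕ→C-layers t (φ Q′))) Q ⟩
        expect lam t (λ Q′ → layers Q′ + ℕ→C (φ Q′ ∸ t)) Q          ≡⟨ expect-+ t layers (λ Q′ → ℕ→C (φ Q′ ∸ t)) Q ⟩
        expect lam t layers Q + expect lam t (λ Q′ → ℕ→C (φ Q′ ∸ t)) Q ≤⟨ +-monoʳ-≤ _ (expect-excess≤0 Q φQ≡0 t) ⟩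
        expect lam t layers Q + 0#                                   ≡⟨ R.+-identityʳ _ ⟩
        expect lam t layers Q                                        ≡⟨ expect-sumUpTo t t (λ j Q′ → [ j ≤ φ Q′ ]) Q ⟩
        sumUpTo t (λ j → expect lam t (λ Q′ → [ j ≤ φ Q′ ]) Q)       ∎
        where
        open ≤-Reasoning
        layers : State m → Carrier
        layers Q′ = sumUpTo t (λ j → [ j ≤ φ Q′ ])

      -- drift: one step of φ is dominated, level by level, by the lazy walk on ℕ that moves
      -- up with probability p, down (when positive) with probability q and stays with probability r
      module _ {p q r ρ : Carrier} (0≤p : 0# ≤ p) (0≤q : 0# ≤ q) (0≤r : 0# ≤ r) (0≤ρ : 0# ≤ ρ)
               (r+[p+q]≡1 : r + (p + q) ≡ 1#) (qρ≡p : q * ρ ≡ p)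
               (drift : ∀ j Q → expect lam 1 (λ Q′ → [ suc j ≤ φ Q′ ]) Q
                                ≤ r * [ suc j ≤ φ Q ] + (q * [ suc (suc j) ≤ φ Q ] + p * [ j ≤ φ Q ])) where

        geometric-fixed-point : ∀ j → r * ρ ^ suc j + (q * ρ ^ suc (suc j) + p * ρ ^ j) ≡ ρ ^ suc j
        geometric-fixed-point j = begin
          r * X + (q * (ρ * X) + p * ρ ^ j) ≡⟨ cong₂ (λ u v → r * X + (u + v)) qρX≡pX pρʲ≡qX ⟩
          r * X + (p * X + q * X)           ≡⟨ solve 4 (λ r p q X → r :* X :+ (p :* X :+ q :* X) := (r :+ (p :+ q)) :* X) refl r p q X ⟩
          (r + (p + q)) * X                 ≡⟨ cong (_* X) r+[p+q]≡1 ⟩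
          1# * X                            ≡⟨ R.*-identityˡ X ⟩
          X                                 ∎
          where
          open ≡-Reasoning
          X : Carrier
          X = ρ ^ suc j
          qρX≡pX : q * (ρ * X) ≡ p * X
          qρX≡pX = trans (sym (R.*-assoc q ρ X)) (cong (_* X) qρ≡p)
          pρʲ≡qX : p * ρ ^ j ≡ q * X
          pρʲ≡qX = trans (cong (_* ρ ^ j) (sym qρ≡p)) (R.*-assoc q ρ (ρ ^ j))

        tail-bound : ∀ Q → φ Q ≡ 0 → ∀ t j → expect lam t (λ Q′ → [ j ≤ φ Q′ ]) Q ≤ ρ ^ j
        tail-bound Q φQ≡0 zero j = subst (λ x → [ j ≤ x ] ≤ ρ ^ j) (sym φQ≡0) (from-empty j)
          where
          from-empty : ∀ j → [ j ≤ 0 ] ≤ ρ ^ j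
          from-empty zero    = ≤-refl
          from-empty (suc j) = ^-nonneg 0≤ρ (suc j)
        tail-bound Q φQ≡0 (suc t) zero    = ≤-reflexive (expect-const (suc t) 1# Q)
        tail-bound Q φQ≡0 (suc t) (suc j) = begin
          expect lam (suc t) (G (suc j)) Q                                 ≡⟨ expect-suc t (G (suc j)) Q ⟩
          expect lam t (expect lam 1 (G (suc j))) Q                        ≤⟨ expect-mono t (drift j) Q ⟩
          expect lam t (λ Q′ → r * G (suc j) Q′ + (q * G (suc (suc j)) Q′ + p * G j Q′)) Q
                                                                           ≡⟨ linearity ⟩
          r * T (suc j) + (q * T (suc (suc j)) + p * T j)                  ≤⟨ induction-hypothesis ⟩
          r * ρ ^ suc j + (q * ρ ^ suc (suc j) + p * ρ ^ j)                ≡⟨ geometric-fixed-point j ⟩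
          ρ ^ suc j                                                        ∎
          where
          open ≤-Reasoning
          G : ℕ → State m → Carrier
          G j Q′ = [ j ≤ φ Q′ ]
          T : ℕ → Carrier
          T j = expect lam t (G j) Q
          induction-hypothesis : r * T (suc j) + (q * T (suc (suc j)) + p * T j)
                                 ≤ r * ρ ^ suc j + (q * ρ ^ suc (suc j) + p * ρ ^ j)
          induction-hypothesis =
            +-mono₂-≤ (*-monoˡ-≤-nonneg 0≤r (tail-bound Q φQ≡0 t (suc j)))
              (+-mono₂-≤ (*-monoˡ-≤-nonneg 0≤q (tail-bound Q φQ≡0 t (suc (suc j))))
                         (*-monoˡ-≤-nonneg 0≤p (tail-bound Q φQ≡0 t j)))
          linearity : expect lam t (λ Q′ → r * G (suc j) Q′ + (q * G (suc (suc j)) Q′ + p * G j Q′)) Q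
                      ≡ r * T (suc j) + (q * T (suc (suc j)) + p * T j)
          linearity = trans (expect-+ t (λ Q′ → r * G (suc j) Q′) (λ Q′ → q * G (suc (suc j)) Q′ + p * G j Q′) Q)
                        (cong₂ _+_ (expect-*ˡ t r (G (suc j)) Q)
                          (trans (expect-+ t (λ Q′ → q * G (suc (suc j)) Q′) (λ Q′ → p * G j Q′) Q)
                            (cong₂ _+_ (expect-*ˡ t q (G (suc (suc j))) Q) (expect-*ˡ t p (G j) Q))))

        mean-bound : ∀ {d} → 0# ≤ d → d + p ≡ q → ∀ Q → φ Q ≡ 0 → ∀ t → d * expect lam t (λ Q′ → ℕ→C (φ Q′)) Q ≤ p
        mean-bound {d} 0≤d d+p≡q Q φQ≡0 t = begin
          d * expect lam t (λ Q′ → ℕ→C (φ Q′)) Q                      ≤⟨ *-monoˡ-≤-nonneg 0≤d (expect-≤-sum-of-tails Q φQ≡0 t) ⟩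
          d * sumUpTo t (λ j → expect lam t (λ Q′ → [ j ≤ φ Q′ ]) Q)  ≤⟨ *-monoˡ-≤-nonneg 0≤d (sumUpTo-mono t (tail-bound Q φQ≡0 t)) ⟩
          d * sumUpTo t (ρ ^_)                                         ≤⟨ geometric-bound 0≤q 0≤ρ d+p≡q qρ≡p t ⟩
          p                                                            ∎
          where open ≤-Reasoning

  module TreePriorityDynamics where

    private
      ≤-of-≡suc : ∀ {n k} → n ≡ suc k → k ℕ.≤ n
      ≤-of-≡suc refl = ℕ.n≤1+n _

    update-≤ : ∀ {m} (Q : State m) j v x → v ℕ.≤ Q j → update Q j v x ℕ.≤ Q x
    update-≤ Q j v x v≤Qj with x Data.Fin.≟ j
    ... | yes refl = v≤Qj
    ... | no _     = ℕ.≤-refl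

    update-≤-suc : ∀ {m} (Q : State m) j v x → v ℕ.≤ suc (Q j) → update Q j v x ℕ.≤ suc (Q x)
    update-≤-suc Q j v x v≤1+Qj with x Data.Fin.≟ j
    ... | yes refl = v≤1+Qj
    ... | no _     = ℕ.n≤1+n _

    update-≢ : ∀ {m} (Q : State m) j v x → x ≢ j → update Q j v x ≡ Q x
    update-≢ Q j v x x≢j with x Data.Fin.≟ j
    ... | yes x≡j = ⊥-elim (x≢j x≡j)
    ... | no _    = refl

    tryRight-≤-of-≢ : ∀ {m} (Q : State m) i x → x ≢ i → tryRight Q i x ℕ.≤ Q x
    tryRight-≤-of-≢ Q i x x≢i with right i
    ... | nothing = ℕ.≤-refl
    ... | just j with Q j in Qj≡
    ...   | zero  = ℕ.≤-reflexive (update-≢ Q i _ x x≢i)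
    ...   | suc k = update-≤ Q j k x (≤-of-≡suc Qj≡)

    step-≤-of-≢ : ∀ {m} (Q : State m) i x → x ≢ i → step Q i x ℕ.≤ Q x
    step-≤-of-≢ Q i x x≢i with left i
    ... | nothing = tryRight-≤-of-≢ Q i x x≢i
    ... | just j with Q j in Qj≡
    ...   | zero  = tryRight-≤-of-≢ Q i x x≢i
    ...   | suc k = update-≤ Q j k x (≤-of-≡suc Qj≡)

    tryRight-≤-suc : ∀ {m} (Q : State m) i x → tryRight Q i x ℕ.≤ suc (Q x)
    tryRight-≤-suc Q i x with right i
    ... | nothing = ℕ.n≤1+n _
    ... | just j with Q j in Qj≡
    ...   | zero  = update-≤-suc Q i _ x ℕ.≤-refl
    ...   | suc k = update-≤-suc Q j k x (ℕ.m≤n⇒m≤1+n (≤-of-≡suc Qj≡))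

    step-≤-suc : ∀ {m} (Q : State m) i x → step Q i x ℕ.≤ suc (Q x)
    step-≤-suc Q i x with left i
    ... | nothing = tryRight-≤-suc Q i x
    ... | just j with Q j in Qj≡
    ...   | zero  = tryRight-≤-suc Q i x
    ...   | suc k = update-≤-suc Q j k x (ℕ.m≤n⇒m≤1+n (≤-of-≡suc Qj≡))

    step₀-serves₁ : ∀ {m} (Q : State (suc m)) → step Q zero (suc zero) ℕ.≤ ℕ.pred (Q (suc zero))
    step₀-serves₁ Q with Q (suc zero) in Q₁≡
    ... | zero  = ℕ.≤-reflexive Q₁≡
    ... | suc _ = ℕ.≤-refl

    step₂-serves₁ : ∀ {m} (Q : State (suc (suc m))) → step Q (suc (suc zero)) (suc zero) ℕ.≤ ℕ.pred (Q (suc zero))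
    step₂-serves₁ Q with Q (suc zero) in Q₁≡
    ... | zero  = subst (tryRight Q (suc (suc zero)) (suc zero) ℕ.≤_) Q₁≡
                        (tryRight-≤-of-≢ Q (suc (suc zero)) (suc zero) (λ ()))
    ... | suc _ = ℕ.≤-refl

  module Queue₁ {m : ℕ}
                (lam : Fin (suc (suc (suc m))) → Carrier) (lam≥0 : ∀ i → 0# ≤ lam i) where
    open OrderedFieldProperties
    open SumProperties
    open TreePriorityDynamics

    served up other : Carrier
    served = lam zero + lam (suc (suc zero))
    up     = lam (suc zero)
    other  = sumF (λ i → lam (suc (suc (suc i))))

    drift : ∀ j Q → expect lam 1 (λ Q′ → [ suc j ≤ Q′ (suc zero) ]) Q
                           ≤ other * [ suc j ≤ Q (suc zero) ]
                             + (served * [ suc (suc j) ≤ Q (suc zero) ] + up * [ j ≤ Q (suc zero) ])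
    drift j Q = begin
      lam zero * G (step Q zero) + (lam (suc zero) * G (step Q (suc zero))
        + (lam (suc (suc zero)) * G (step Q (suc (suc zero))) + sumF (λ i → lam (suc (suc (suc i))) * G (step Q (suc (suc (suc i)))))))
        ≤⟨ +-mono₂-≤ (*-monoˡ-≤-nonneg (lam≥0 zero) (served-by (step₀-serves₁ Q)))
             (+-mono₂-≤ (*-monoˡ-≤-nonneg (lam≥0 (suc zero)) ([≤]-mono (suc j) (step-≤-suc Q (suc zero) (suc zero))))
               (+-mono₂-≤ (*-monoˡ-≤-nonneg (lam≥0 (suc (suc zero))) (served-by (step₂-serves₁ Q)))
                 (sumF-mono (λ i → *-monoˡ-≤-nonneg (lam≥0 (suc (suc (suc i))))
                   ([≤]-mono (suc j) (step-≤-of-≢ Q (suc (suc (suc i))) (suc zero) (λ ()))))))) ⟩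
      lam zero * A + (lam (suc zero) * B + (lam (suc (suc zero)) * A + sumF (λ i → lam (suc (suc (suc i))) * C)))
        ≡⟨ cong (λ w → lam zero * A + (lam (suc zero) * B + (lam (suc (suc zero)) * A + w))) (sumF-*ʳ C (λ i → lam (suc (suc (suc i))))) ⟩
      lam zero * A + (lam (suc zero) * B + (lam (suc (suc zero)) * A + other * C))
        ≡⟨ solve 7 (λ l₀ l₁ l₂ o A B C → l₀ :* A :+ (l₁ :* B :+ (l₂ :* A :+ o :* C)) := o :* C :+ ((l₀ :+ l₂) :* A :+ l₁ :* B))
                 refl (lam zero) (lam (suc zero)) (lam (suc (suc zero))) other A B C ⟩
      other * C + (served * A + up * B) ∎
      where
      open ≤-Reasoning
      G : State (suc (suc m)) → Carrier
      G Q′ = [ suc j ≤ Q′ (suc zero) ]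
      A B C : Carrier
      A = [ suc (suc j) ≤ Q (suc zero) ]
      B = [ j ≤ Q (suc zero) ]
      C = [ suc j ≤ Q (suc zero) ]
      served-by : ∀ {x} → x ℕ.≤ ℕ.pred (Q (suc zero)) → [ suc j ≤ x ] ≤ A
      served-by {x} x≤ = subst ([ suc j ≤ x ] ≤_) ([≤]-pred j (Q (suc zero))) ([≤]-mono (suc j) x≤)

    mean-bound-from-empty : sumF lam ≡ 1# → served ≢ 0# → ∀ {d} → 0# ≤ d → d + up ≡ served →
                        ∀ t → d * expect lam t (λ Q → ℕ→C (Q (suc zero))) empty ≤ up
    mean-bound-from-empty Σlam≡1 served≢0 0≤d d+up≡served =
      mean-bound (λ Q → Q (suc zero)) (λ Q i → step-≤-suc Q i (suc zero))
        (lam≥0 (suc zero)) 0≤served (sumF-nonneg (λ i → lam≥0 (suc (suc (suc i))))) 0≤ρ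
        other+[up+served]≡1 servedρ≡up drift 0≤d d+up≡served empty refl
      where
      open Expectation lam lam≥0 Σlam≡1
      0≤served : 0# ≤ served
      0≤served = +-nonneg (lam≥0 zero) (lam≥0 (suc (suc zero)))
      other+[up+served]≡1 : other + (up + served) ≡ 1#
      other+[up+served]≡1 =
        trans (solve 4 (λ l₀ l₁ l₂ o → o :+ (l₁ :+ (l₀ :+ l₂)) := l₀ :+ (l₁ :+ (l₂ :+ o))) refl
                       (lam zero) (lam (suc zero)) (lam (suc (suc zero))) other)
              Σlam≡1
      served⁻¹ : Carrier
      served⁻¹ = proj₁ (inverse served served≢0)
      ρ : Carrier
      ρ = up * served⁻¹
      0≤ρ : 0# ≤ ρ
      0≤ρ = *-nonneg (lam≥0 (suc zero)) (inverse-nonneg 0≤served (proj₂ (inverse served served≢0)))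
      servedρ≡up : served * ρ ≡ up
      servedρ≡up = begin
        served * (up * served⁻¹) ≡⟨ solve 3 (λ s u s⁻¹ → s :* (u :* s⁻¹) := u :* (s :* s⁻¹)) refl served up served⁻¹ ⟩
        up * (served * served⁻¹) ≡⟨ cong (up *_) (proj₂ (inverse served served≢0)) ⟩
        up * 1#                  ≡⟨ R.*-identityʳ up ⟩
        up                       ∎
        where open ≡-Reasoning

  module PathBalance where
    open OrderedFieldProperties
    open SumProperties

    sumF-0* : ∀ {k} (f : Fin k → Carrier) → sumF (λ j → 0# * f j) ≡ 0#
    sumF-0* f = trans (sumF-*ˡ 0# f) (R.zeroˡ _)

    module _ {k : ℕ} (z : Fin (suc (suc (suc k))) → Carrier) where
      private
        R₀ : sumF (λ j → 0# * z (suc (suc (suc j)))) ≡ 0#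
        R₀ = sumF-0* (λ j → z (suc (suc (suc j))))

      Mz-type₀ : Mz z zero ≡ z zero
      Mz-type₀ = trans (cong (λ w → 1# * z zero + (0# * z (suc zero) + (0# * z (suc (suc zero)) + w))) R₀)
                       (solve 3 (λ a b c → con 1 :* a :+ (con 0 :* b :+ (con 0 :* c :+ con 0)) := a) refl _ _ _)

      Mz-type₁ : Mz z (suc zero) ≡ z zero + z (suc zero)
      Mz-type₁ = trans (cong (λ w → 1# * z zero + (1# * z (suc zero) + (0# * z (suc (suc zero)) + w))) R₀)
                       (solve 3 (λ a b c → con 1 :* a :+ (con 1 :* b :+ (con 0 :* c :+ con 0)) := a :+ b) refl _ _ _)

      Mz-type₂ : Mz z (suc (suc zero)) ≡ z (suc zero) + z (suc (suc zero))
      Mz-type₂ = trans (cong (λ w → 0# * z zero + (1# * z (suc zero) + (1# * z (suc (suc zero)) + w))) R₀)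
                       (solve 3 (λ a b c → con 0 :* a :+ (con 1 :* b :+ (con 1 :* c :+ con 0)) := b :+ c) refl _ _ _)

      balance : (lam s : Fin (suc (suc (suc (suc k)))) → Carrier) → (∀ i → Mz z i + s i ≡ lam i) → s (suc zero) ≡ 0# →
                (z (suc (suc zero)) + s zero + s (suc (suc zero))) + lam (suc zero) ≡ lam zero + lam (suc (suc zero))
      balance lam s Mz+s≡lam s₁≡0 = begin
        (z₂ + s zero + s₂) + lam (suc zero)                   ≡⟨ cong ((z₂ + s zero + s₂) +_) (sym (Mz+s≡lam (suc zero))) ⟩
        (z₂ + s zero + s₂) + (Mz z (suc zero) + s (suc zero)) ≡⟨ cong₂ (λ u v → (z₂ + s zero + s₂) + (u + v)) Mz-type₁ s₁≡0 ⟩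
        (z₂ + s zero + s₂) + (z zero + z₁ + 0#)               ≡⟨ solve 5 (λ z₀ z₁ z₂ s₀ s₂ → (z₂ :+ s₀ :+ s₂) :+ (z₀ :+ z₁ :+ con 0)
                                                                            := (z₀ :+ s₀) :+ ((z₁ :+ z₂) :+ s₂)) refl (z zero) z₁ z₂ (s zero) s₂ ⟩
        (z zero + s zero) + ((z₁ + z₂) + s₂)                  ≡⟨ cong₂ (λ u v → (u + s zero) + (v + s₂)) (sym Mz-type₀) (sym Mz-type₂) ⟩
        (Mz z zero + s zero) + (Mz z (suc (suc zero)) + s₂)   ≡⟨ cong₂ _+_ (Mz+s≡lam zero) (Mz+s≡lam (suc (suc zero))) ⟩
        lam zero + lam (suc (suc zero))                       ∎
        where
        open ≡-Reasoning
        z₁ z₂ s₂ : Carrier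
        z₁ = z (suc zero)
        z₂ = z (suc (suc zero))
        s₂ = s (suc (suc zero))

mainTheorem16 : (F : OrderedField) → let open PathNetwork F in
    (k : ℕ) →
    (lam : Fin (suc (suc (suc (suc k)))) → Carrier) → (r : Fin (suc (suc (suc k))) → Carrier) →
    (∀ i → 0# < lam i) → sumF lam ≡ 1# → (∀ j → 0# < r j) →
    (z : Fin (suc (suc (suc k))) → Carrier) → (s : Fin (suc (suc (suc (suc k)))) → Carrier) →
    Optimal r lam z s →
    (∀ j → 0# < z j) →
    (∀ i → 0# < s i → i ≡ fromℕ (suc (suc (suc k)))) → 0# < s (fromℕ (suc (suc (suc k)))) →
    (ε : Carrier) →
    (∀ j → ε ≤ z j) → ε ≤ s (fromℕ (suc (suc (suc k)))) →
    (ε ≡ s (fromℕ (suc (suc (suc k)))) ⊎ Σ (Fin (suc (suc (suc k)))) (λ j → ε ≡ z j)) →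
    (t : ℕ) → 1 Data.Nat.≤ t →
    ε * expect lam t (λ Q → ℕ→C (Q (suc zero))) empty ≤ 1# + 1#
mainTheorem16 F k lam _ 0<lam Σlam≡1 _ z s ((Mz+s≡lam , _ , 0≤s) , _) 0<z only-last-positive _ ε ε≤z _ _ t _ =
  ≤-stable-< 1<1+1 (λ ¬bound → ¬¬s₁≡0 (λ s₁≡0 → ¬bound (bound s₁≡0)))
  where
  open PathNetwork F
  open OrderedFieldProperties F
  open SumProperties F
  open PathBalance F
  lam≥0 : ∀ i → 0# ≤ lam i
  lam≥0 i = proj₁ (0<lam i)
  open Expectation F lam lam≥0 Σlam≡1
  open Queue₁ F lam lam≥0

  ¬¬s₁≡0 : ¬ ¬ (s (suc zero) ≡ 0#)
  ¬¬s₁≡0 s₁≢0 with only-last-positive (suc zero) (0≤s (suc zero) , λ 0≡s₁ → s₁≢0 (sym 0≡s₁))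
  ... | ()

  bound : s (suc zero) ≡ 0# → ε * expect lam t (λ Q → ℕ→C (Q (suc zero))) empty ≤ 1#
  bound s₁≡0 = begin
    ε * X  ≤⟨ *-monoʳ-≤-nonneg (expect-nonneg t (λ Q → ℕ→C-nonneg (Q (suc zero))) empty) ε≤d ⟩
    d * X  ≤⟨ mean-bound-from-empty Σlam≡1 (pos+nonneg≢0 (0<lam zero) (lam≥0 (suc (suc zero)))) 0≤d
                (balance z lam s Mz+s≡lam s₁≡0) t ⟩
    up     ≤⟨ subst (up ≤_) Σlam≡1 (≤-sumF lam≥0 (suc zero)) ⟩
    1#     ∎
    where
    open ≤-Reasoning
    X d : Carrier
    X = expect lam t (λ Q → ℕ→C (Q (suc zero))) empty
    d = z (suc (suc zero)) + s zero + s (suc (suc zero))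
    z₂≤d : z (suc (suc zero)) ≤ d
    z₂≤d = ≤-trans (x≤x+y _ (0≤s zero)) (x≤x+y _ (0≤s (suc (suc zero))))
    ε≤d : ε ≤ d
    ε≤d = ≤-trans (ε≤z (suc (suc zero))) z₂≤d
    0≤d : 0# ≤ d
    0≤d = ≤-trans (proj₁ (0<z (suc (suc zero)))) z₂≤d
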